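{- Let $K$ be a field of characteristic zero (e.g. $K=\mathbb{C}$ or $K=\mathbb{C}_p$), let $t$ be an indeterminate and $D=\frac{d}{dt}$ (acting on $K[t]$). Let $m\ge 2$ and let $T,Q_1,\dots,Q_m\in K[t]$ with $S'=\deg T$ and $r'_j=\deg Q_j$ ($j=1,\dots,m$), where $\deg$ of the zero polynomial is $-\infty$. Assume either $$S'\ge 0,\qquad r'_m=S'+1,\qquad r'_j<r'_m\ \text{ for all } j=1,\dots,m-1,$$ or $$r'_m\ge 0,\qquad S'=r'_m+1,\qquad r'_j\le r'_m\ \text{ for all } j=1,\dots,m.$$ Let $B_{0,1},\dots,B_{0,m}\in K[t]$ with $(B_{0,1},\dots,B_{0,m})\neq(0,\dots,0)$, and define polynomials $B_{n,j}\in K[t]$ for $n\ge 0$ recursively by $$B_{k+1,j}=Q_jB_{k,1}+T\,DB_{k,j}+T B_{k,j+1}\quad (j=1,\dots,m-1),\qquad B_{k+1,m}=Q_mB_{k,1}+T\,DB_{k,m},$$ for all $k\in\mathbb{N}$. Then for every $k\in\mathbb{N}$ the $m\times m$ determinant $$\det\mathcal{B}_k=\det\big(B_{k+i-1,j}\big)_{1\le i,j\le m}$$ is a nonzero polynomial.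
   Context: The polynomials $B_{n,j}$ are the coefficients of the linear forms $R_n=(TD)^nR=B_{n,1}D^{m-1}F+\dots+B_{n,m}D^0F$, where $R=B_{0,1}D^{m-1}F+\dots+B_{0,m}D^0F$ and $F$ is a nonzero function satisfying $TD^mF=Q_1D^{m-1}F+\dots+Q_mD^0F$; the recurrences above are obtained by applying $TD$ and using this differential equation to eliminate $D^mF$. $\mathbb{N}$ includes $0$. -}

module Defs where

open import Level using (Level; _⊔_) renaming (suc to lsuc)
open import Algebra.Bundles using (CommutativeRing)
open import Data.Nat using (ℕ; zero; suc; _<_; _≤_) renaming (_+_ to _+ℕ_)
open import Data.Fin using (Fin; zero; suc; punchIn; toℕ; fromℕ)
open import Data.List using (List; []; _∷_; map)
open import Data.Product using (∃; _×_)
open import Function using (_∘_)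
open import Relation.Nullary using (¬_)

record Field (c ℓ : Level) : Set (lsuc (c ⊔ ℓ)) where
  field
    commutativeRing : CommutativeRing c ℓ
  open CommutativeRing commutativeRing public
  field
    0≉1     : ¬ (0# ≈ 1#)
    inverse : ∀ x → ¬ (x ≈ 0#) → ∃ λ y → (x * y) ≈ 1#

module FieldOps {c ℓ : Level} (F : Field c ℓ) where
  open Field F hiding (zero)

  ntimes : ℕ → Carrier → Carrier
  ntimes zero    x = 0#
  ntimes (suc n) x = x + ntimes n x

  CharZero : Set ℓ
  CharZero = ∀ n → ¬ (ntimes (suc n) 1# ≈ 0#)

  -- Polynomials K[t], as coefficient lists  a₀ ∷ a₁ ∷ a₂ ∷ …  (a_i = coefficient of t^i),
  -- compared up to trailing zeros via coefficientwise equality.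
  Poly : Set c
  Poly = List Carrier

  coeff : Poly → ℕ → Carrier
  coeff []      _       = 0#
  coeff (a ∷ p) zero    = a
  coeff (a ∷ p) (suc i) = coeff p i

  IsZeroPoly : Poly → Set ℓ
  IsZeroPoly p = ∀ i → coeff p i ≈ 0#

  HasDeg : Poly → ℕ → Set ℓ
  HasDeg p d = ¬ (coeff p d ≈ 0#) × (∀ i → d < i → coeff p i ≈ 0#)

  -- deg p < d, where deg 0 = -∞ (so the zero polynomial satisfies it)
  DegLt : Poly → ℕ → Set ℓ
  DegLt p d = ∀ i → d ≤ i → coeff p i ≈ 0#

  _⊕_ : Poly → Poly → Poly
  []      ⊕ q       = q
  (a ∷ p) ⊕ []      = a ∷ p
  (a ∷ p) ⊕ (b ∷ q) = (a + b) ∷ (p ⊕ q)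

  scale : Carrier → Poly → Poly
  scale a = map (a *_)

  neg : Poly → Poly
  neg = map (-_)

  _⊗_ : Poly → Poly → Poly
  []      ⊗ q = []
  (a ∷ p) ⊗ q = scale a q ⊕ (0# ∷ (p ⊗ q))

  one : Poly
  one = 1# ∷ []

  derivFrom : ℕ → Poly → Poly
  derivFrom n []      = []
  derivFrom n (b ∷ p) = ntimes n b ∷ derivFrom (suc n) p

  D : Poly → Poly
  D []      = []
  D (a ∷ p) = derivFrom 1 p

  sumFin : ∀ {n} → (Fin n → Poly) → Poly
  sumFin {zero}  f = []
  sumFin {suc n} f = f zero ⊕ sumFin (f ∘ suc)

  altSign : ℕ → Poly → Poly
  altSign zero    p = p
  altSign (suc k) p = neg (altSign k p)

  det : ∀ {n} → (Fin n → Fin n → Poly) → Poly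
  det {zero}  M = one
  det {suc n} M =
    sumFin (λ j → altSign (toℕ j) (M zero j ⊗ det (λ a b → M (suc a) (punchIn j b))))

  -- The sequence B_{k,j}; indices j = 1..m are Fin m with 1 ↦ zero.
  -- nextOr v j = v (j+1) if j < m, and 0 if j = m.
  nextOr : ∀ {m} → (Fin m → Poly) → Fin m → Poly
  nextOr {suc zero}    v zero    = []
  nextOr {suc (suc m)} v zero    = v (suc zero)
  nextOr {suc (suc m)} v (suc j) = nextOr (v ∘ suc) j

  Bseq : ∀ {m} → (T : Poly) → (Q : Fin m → Poly) → (B₀ : Fin m → Poly)
       → ℕ → Fin m → Poly
  Bseq T Q B₀ zero    j = B₀ j
  Bseq {suc m} T Q B₀ (suc k) j =
    (Q j ⊗ Bseq T Q B₀ k zero) ⊕ ((T ⊗ D (Bseq T Q B₀ k j)) ⊕ (T ⊗ nextOr (Bseq T Q B₀ k) j))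

  detB : ∀ {m} → (T : Poly) → (Q : Fin m → Poly) → (B₀ : Fin m → Poly) → ℕ → Poly
  detB T Q B₀ k = det (λ i j → Bseq T Q B₀ (k +ℕ toℕ i) j)

{-# OPTIONS --safe #-}

-- Give column j of a row (B_{k,1}, …, B_{k,m}) the weight β_j < m, with the β_j
-- pairwise distinct, and measure an entry p of that column by its weighted degree
-- m · deg p + β_j.  Distinct columns then never tie, so every nonzero row has a
-- unique column of largest weighted degree.  The degree hypotheses make one step
-- of the recurrence raise this maximum by a fixed δ and move it one column to the
-- left, cyclically (column 1 goes to column m), the new leading term being produced
-- by multiplication with T or Q_m alone.  Hence the m consecutive rows of 𝓑_k have
-- pairwise distinct leading columns, and in the Laplace expansion of det 𝓑_k the
-- coefficient of highest degree is, up to sign, a product of leading coefficients.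

module Submission where

open import Defs
open import Level using (Level)
import Algebra.Properties.CommutativeMonoid.Sum as MonoidSum
open import Data.Empty using (⊥)
open import Data.Fin using (Fin; zero; suc; fromℕ; toℕ; inject₁; punchIn; punchOut)
open import Data.Fin.Properties
  using (toℕ-inject₁; toℕ-fromℕ; toℕ-injective; toℕ<n; toℕ≤pred[n]; suc-injective;
         fromℕ≢inject₁; punchIn-punchOut; punchIn-injective; punchOut-injective)
open import Data.Fin.Relation.Unary.Top using (view; ‵fromℕ; ‵inject₁)
open import Data.List using ([]; _∷_; allFin)
open import Data.List.Extrema.Nat using (argmax; v≤f[argmax]⁺)
open import Data.List.Membership.Propositional.Properties using (∈-allFin)
import Data.List.Relation.Unary.Any as Any
open import Data.Nat using (ℕ; zero; suc; _+_; _*_; _∸_; _≤_; _<_; s≤s; NonZero; >-nonZero⁻¹)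
open import Data.Nat.DivMod using (_%_; [m+kn]%n≡m%n; m<n⇒m%n≡m)
open import Data.Nat.Properties
  using (+-0-commutativeMonoid; +-assoc; +-comm; +-identityʳ; +-suc; *-comm; *-zeroʳ;
         +-cancelˡ-≡; +-cancelʳ-<; *-cancelˡ-<; +-monoˡ-≤; +-monoʳ-≤; +-monoˡ-<; *-monoʳ-<; +-∸-assoc;
         ≤-refl; ≤-reflexive; ≤-trans; ≤-<-trans; <⇒≤; <-asym; <-irrefl; ≤⇒≯; ≮⇒≥; ≤∧≢⇒<; _<?_;
         m≤m+n; m≤n+m; m<n+m; n≤1+n; m∸n≤m; n∸n≡0; ∸-cancelˡ-≡; module ≤-Reasoning)
open import Data.Nat.Tactic.RingSolver using (solve-∀)
open import Data.Product using (∃; _×_; _,_; proj₁; proj₂)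
open import Data.Sum as Sum using (_⊎_; inj₁; inj₂)
open import Function using (_∘_)
open import Function.Definitions using (Injective)
open import Relation.Binary.PropositionalEquality
  using (_≡_; _≢_; refl; sym; trans; cong; cong₂; subst; module ≡-Reasoning)
open import Relation.Nullary using (¬_; yes; no; contradiction)
import Relation.Binary.Reasoning.Setoid as SetoidReasoning

open MonoidSum +-0-commutativeMonoid using (sum; sum-remove)

-- Natural-number arithmetic of weighted degrees

*-suc-+ : ∀ w d a → w * suc d + a ≡ w * d + (w + a)
*-suc-+ = solve-∀

<-transfer : ∀ {A a A′ a′} X → A + a′ ≤ A′ + a → A′ < X + a′ → A < X + a
<-transfer {A} {a} {A′} {a′} X le lt = +-cancelʳ-< a′ A (X + a) (begin-strict
  A + a′        ≤⟨ le ⟩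
  A′ + a        <⟨ +-monoˡ-< a lt ⟩
  X + a′ + a    ≡⟨ swap X a′ a ⟩
  X + a + a′    ∎)
  where
  open ≤-Reasoning
  swap : ∀ x y z → x + y + z ≡ x + z + y
  swap = solve-∀

<-split : ∀ {a A B b} X → a ≤ A → A + B < X + (a + b) → B < X + b
<-split {a} {A} {B} {b} X a≤A = <-transfer X (begin
  B + (a + b)  ≡⟨ swap B a b ⟩
  a + B + b    ≤⟨ +-monoˡ-≤ b (+-monoˡ-≤ B a≤A) ⟩
  A + B + b    ∎)
  where
  open ≤-Reasoning
  swap : ∀ x y z → x + (y + z) ≡ y + x + z
  swap = solve-∀

<-suc-tight : ∀ {X b A} → X + b ≡ A → A < X + suc b
<-suc-tight {X} {b} refl = ≤-reflexive (sym (+-suc X b))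

shift-≤ : ∀ {S a δ b} W → S + a ≤ δ + b → S + W + a ≤ W + δ + b
shift-≤ {S} {a} {δ} {b} W le = begin
  S + W + a    ≡⟨ swap S W a ⟩
  S + a + W    ≤⟨ +-monoˡ-≤ W le ⟩
  δ + b + W    ≡⟨ swap′ δ b W ⟩
  W + δ + b    ∎
  where
  open ≤-Reasoning
  swap : ∀ x y z → x + y + z ≡ x + z + y
  swap = solve-∀
  swap′ : ∀ x y z → x + y + z ≡ z + x + y
  swap′ = solve-∀

+-suc-≤ : ∀ {x y} z b → x + 1 ≤ y + z → x + suc b ≤ y + (z + b)
+-suc-≤ {x} {y} z b le = begin
  x + suc b    ≡⟨ +-assoc x 1 b ⟨
  x + 1 + b    ≤⟨ +-monoˡ-≤ b le ⟩
  y + z + b    ≡⟨ +-assoc y z b ⟩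
  y + (z + b)  ∎
  where open ≤-Reasoning

+-suc-≡ : ∀ {x b y b′} → x + b ≡ y + b′ → x + suc b ≡ y + suc b′
+-suc-≡ {x} {b} {y} {b′} eq = trans (+-suc x b) (trans (cong suc eq) (sym (+-suc y b′)))

tight-shift : ∀ w s {e b W b′ δ} → w * e + b ≡ W → w * s + b′ ≡ δ + b → w * (s + e) + b′ ≡ W + δ
tight-shift w s {e} {b} {W} {b′} {δ} refl eq = begin
  w * (s + e) + b′    ≡⟨ regroup w s e b′ ⟩
  w * e + (w * s + b′) ≡⟨ cong (w * e +_) eq ⟩
  w * e + (δ + b)     ≡⟨ regroup′ (w * e) δ b ⟩
  w * e + b + δ       ∎
  where
  open ≡-Reasoning
  regroup : ∀ w s e b → w * (s + e) + b ≡ w * e + (w * s + b)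
  regroup = solve-∀
  regroup′ : ∀ x y z → x + (y + z) ≡ x + z + y
  regroup′ = solve-∀

[w*d+b]%w≡b : ∀ {w d b} .{{_ : NonZero w}} → b < w → (w * d + b) % w ≡ b
[w*d+b]%w≡b {w} {d} {b} b<w = begin
  (w * d + b) % w  ≡⟨ cong (_% w) (trans (+-comm (w * d) b) (cong (b +_) (*-comm w d))) ⟩
  (b + d * w) % w  ≡⟨ [m+kn]%n≡m%n b d w ⟩
  b % w            ≡⟨ m<n⇒m%n≡m b<w ⟩
  b                ∎
  where
  open ≡-Reasoning

digit-unique : ∀ {w d d′ b b′} .{{_ : NonZero w}} → b < w → b′ < w → w * d + b ≡ w * d′ + b′ → b ≡ b′
digit-unique {w} b<w b′<w eq =
  trans (sym ([w*d+b]%w≡b b<w)) (trans (cong (_% w) eq) ([w*d+b]%w≡b b′<w))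

*-+-cancel-< : ∀ w {d i a A} → w * d + a ≤ A → A < w * i + a → d < i
*-+-cancel-< w {d} {i} {a} le lt = *-cancelˡ-< w d i (+-cancelʳ-< a (w * d) (w * i) (≤-<-trans le lt))

tight-at-0⇒< : ∀ w .{{_ : NonZero w}} {a A} i → w * 0 + a ≡ A → A < w * i + (w + a)
tight-at-0⇒< w {a} i refl = begin-strict
  w * 0 + a        ≡⟨ cong (_+ a) (*-zeroʳ w) ⟩
  a                <⟨ m<n+m a (>-nonZero⁻¹ w) ⟩
  w + a            ≤⟨ m≤n+m (w + a) (w * i) ⟩
  w * i + (w + a)  ∎
  where open ≤-Reasoning

-- The cyclic predecessor on Fin (suc n)

cyclicPred : ∀ {n} → Fin (suc n) → Fin (suc n)
cyclicPred zero    = fromℕ _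
cyclicPred (suc i) = inject₁ i

cyclicPred^ : ∀ {n} → ℕ → Fin (suc n) → Fin (suc n)
cyclicPred^ zero    c = c
cyclicPred^ (suc i) c = cyclicPred (cyclicPred^ i c)

toℕ-cyclicPred^ : ∀ {n} (c : Fin (suc n)) i → i ≤ n →
  toℕ (cyclicPred^ i c) + i ≡ toℕ c ⊎ toℕ (cyclicPred^ i c) + i ≡ toℕ c + suc n
toℕ-cyclicPred^ c zero _ = inj₁ (+-identityʳ _)
toℕ-cyclicPred^ {n} c (suc i) i<n with cyclicPred^ i c | toℕ-cyclicPred^ c i (<⇒≤ i<n)
... | zero  | inj₁ i≡c  = inj₂ (begin
  toℕ (fromℕ n) + suc i  ≡⟨ cong (_+ suc i) (toℕ-fromℕ n) ⟩
  n + suc i              ≡⟨ +-comm n (suc i) ⟩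
  suc i + n              ≡⟨ +-suc i n ⟨
  i + suc n              ≡⟨ cong (_+ suc n) i≡c ⟩
  toℕ c + suc n          ∎)
  where open ≡-Reasoning
... | zero  | inj₂ i≡c+n =
  contradiction i<n (<-asym (≤-trans (m≤n+m (suc n) (toℕ c)) (≤-reflexive (sym i≡c+n))))
... | suc x | eq = Sum.map step step eq
  where
  step : ∀ {C} → suc (toℕ x) + i ≡ C → toℕ (inject₁ x) + suc i ≡ C
  step eq = trans (cong (_+ suc i) (toℕ-inject₁ x)) (trans (+-suc (toℕ x) i) eq)

same-residue : ∀ {x a b C m} → a < m → b < m →
  x + a ≡ C ⊎ x + a ≡ C + m → x + b ≡ C ⊎ x + b ≡ C + m → a ≡ b
same-residue _ _ (inj₁ p) (inj₁ q) = +-cancelˡ-≡ _ _ _ (trans p (sym q))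
same-residue _ _ (inj₂ p) (inj₂ q) = +-cancelˡ-≡ _ _ _ (trans p (sym q))
same-residue _ b<m (inj₁ p) (inj₂ q) = contradiction b<m (wrapped p q)
  where
  wrapped : ∀ {x a b C m} → x + a ≡ C → x + b ≡ C + m → ¬ b < m
  wrapped {x} {a} {b} {C} {m} p q = ≤⇒≯ (begin
    m      ≤⟨ m≤n+m m a ⟩
    a + m  ≡⟨ +-cancelˡ-≡ x _ _ (trans (sym (+-assoc x a m)) (trans (cong (_+ m) p) (sym q))) ⟩
    b      ∎)
    where open ≤-Reasoning
same-residue a<m b<m (inj₂ p) (inj₁ q) = sym (same-residue b<m a<m (inj₁ q) (inj₂ p))

cyclicPred^-injective : ∀ {n} (c : Fin (suc n)) {a b} → a ≤ n → b ≤ n →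
  cyclicPred^ a c ≡ cyclicPred^ b c → a ≡ b
cyclicPred^-injective {n} c {a} {b} a≤n b≤n eq =
  same-residue (s≤s a≤n) (s≤s b≤n) (toℕ-cyclicPred^ c a a≤n)
    (subst (λ d → toℕ d + b ≡ toℕ c ⊎ toℕ d + b ≡ toℕ c + suc n) (sym eq) (toℕ-cyclicPred^ c b b≤n))

maximum-attained : ∀ {m} (f : Fin (suc m) → ℕ) → ∃ λ c → ∀ j → f j ≤ f c
maximum-attained f =
  argmax f zero (allFin _) ,
  λ j → v≤f[argmax]⁺ {f = f} zero (allFin _) (inj₂ (Any.map (λ { refl → ≤-refl }) (∈-allFin j)))

-- Polynomials over a field

module _ {a ℓ : Level} (F : Field a ℓ) where

  module F = Field F
  open F using (Carrier; _≈_; 0#; 1#)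
  open FieldOps F
  open import Algebra.Properties.Ring F.ring using (-0#≈0#; -‿injective)
  module ≈-Reasoning = SetoidReasoning F.setoid

  x≈0∧y≈0⇒x+y≈0 : ∀ {x y} → x ≈ 0# → y ≈ 0# → x F.+ y ≈ 0#
  x≈0∧y≈0⇒x+y≈0 x≈0 y≈0 = F.trans (F.+-cong x≈0 y≈0) (F.+-identityˡ 0#)

  x≈0⇒x+y≈y : ∀ {x y} → x ≈ 0# → x F.+ y ≈ y
  x≈0⇒x+y≈y {y = y} x≈0 = F.trans (F.+-congʳ x≈0) (F.+-identityˡ y)

  y≈0⇒x+y≈x : ∀ {x y} → y ≈ 0# → x F.+ y ≈ x
  y≈0⇒x+y≈x {x} y≈0 = F.trans (F.+-congˡ y≈0) (F.+-identityʳ x)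

  x≈0⇒x*y≈0 : ∀ {x y} → x ≈ 0# → x F.* y ≈ 0#
  x≈0⇒x*y≈0 {y = y} x≈0 = F.trans (F.*-congʳ x≈0) (F.zeroˡ y)

  y≈0⇒x*y≈0 : ∀ {x y} → y ≈ 0# → x F.* y ≈ 0#
  y≈0⇒x*y≈0 {x} y≈0 = F.trans (F.*-congˡ y≈0) (F.zeroʳ x)

  x≈0⇒-x≈0 : ∀ {x} → x ≈ 0# → F.- x ≈ 0#
  x≈0⇒-x≈0 x≈0 = F.trans (F.-‿cong x≈0) -0#≈0#

  -x≈0⇒x≈0 : ∀ {x} → F.- x ≈ 0# → x ≈ 0#
  -x≈0⇒x≈0 -x≈0 = -‿injective (F.trans -x≈0 (F.sym -0#≈0#))

  x≉0∧y≉0⇒x*y≉0 : ∀ {x y} → ¬ x ≈ 0# → ¬ y ≈ 0# → ¬ x F.* y ≈ 0#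
  x≉0∧y≉0⇒x*y≉0 {x} {y} x≉0 y≉0 xy≈0 with F.inverse y y≉0
  ... | y⁻¹ , yy⁻¹≈1 = x≉0 (begin
    x                 ≈⟨ F.*-identityʳ x ⟨
    x F.* 1#          ≈⟨ F.*-congˡ yy⁻¹≈1 ⟨
    x F.* (y F.* y⁻¹) ≈⟨ F.*-assoc x y y⁻¹ ⟨
    x F.* y F.* y⁻¹   ≈⟨ x≈0⇒x*y≈0 xy≈0 ⟩
    0#                ∎)
    where open ≈-Reasoning

  ntimes-0 : ∀ k {x} → x ≈ 0# → ntimes k x ≈ 0#
  ntimes-0 zero    _   = F.refl
  ntimes-0 (suc k) x≈0 = x≈0∧y≈0⇒x+y≈0 x≈0 (ntimes-0 k x≈0)

  coeff-⊕ : ∀ p q d → coeff (p ⊕ q) d ≈ coeff p d F.+ coeff q d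
  coeff-⊕ []      q       d       = F.sym (F.+-identityˡ _)
  coeff-⊕ (x ∷ p) []      zero    = F.sym (F.+-identityʳ _)
  coeff-⊕ (x ∷ p) []      (suc d) = F.sym (F.+-identityʳ _)
  coeff-⊕ (x ∷ p) (y ∷ q) zero    = F.refl
  coeff-⊕ (x ∷ p) (y ∷ q) (suc d) = coeff-⊕ p q d

  coeff-neg : ∀ p d → coeff (neg p) d ≈ F.- coeff p d
  coeff-neg []      d       = F.sym -0#≈0#
  coeff-neg (x ∷ p) zero    = F.refl
  coeff-neg (x ∷ p) (suc d) = coeff-neg p d

  coeff-scale : ∀ x p d → coeff (scale x p) d ≈ x F.* coeff p d
  coeff-scale x []      d       = F.sym (F.zeroʳ x)
  coeff-scale x (y ∷ p) zero    = F.refl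
  coeff-scale x (y ∷ p) (suc d) = coeff-scale x p d

  coeff-∷-⊗ : ∀ x p q d → coeff ((x ∷ p) ⊗ q) d ≈ x F.* coeff q d F.+ coeff (0# ∷ (p ⊗ q)) d
  coeff-∷-⊗ x p q d = F.trans (coeff-⊕ (scale x q) (0# ∷ (p ⊗ q)) d) (F.+-congʳ (coeff-scale x q d))

  coeff-derivFrom : ∀ k p d → coeff (derivFrom k p) d ≈ ntimes (k + d) (coeff p d)
  coeff-derivFrom k []      d = F.sym (ntimes-0 (k + d) F.refl)
  coeff-derivFrom k (x ∷ p) zero    rewrite +-identityʳ k = F.refl
  coeff-derivFrom k (x ∷ p) (suc d) rewrite +-suc k d     = coeff-derivFrom (suc k) p d

  coeff-D : ∀ p d → coeff (D p) d ≈ ntimes (suc d) (coeff p (suc d))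
  coeff-D []      d = F.sym (ntimes-0 (suc d) F.refl)
  coeff-D (x ∷ p) d = coeff-derivFrom 1 p d

  coeff-⊕-⊕ˡ : ∀ p q r d → coeff q d ≈ 0# → coeff r d ≈ 0# → coeff (p ⊕ (q ⊕ r)) d ≈ coeff p d
  coeff-⊕-⊕ˡ p q r d q≈0 r≈0 = begin
    coeff (p ⊕ (q ⊕ r)) d                    ≈⟨ coeff-⊕ p (q ⊕ r) d ⟩
    coeff p d F.+ coeff (q ⊕ r) d            ≈⟨ F.+-congˡ (coeff-⊕ q r d) ⟩
    coeff p d F.+ (coeff q d F.+ coeff r d)  ≈⟨ y≈0⇒x+y≈x (x≈0∧y≈0⇒x+y≈0 q≈0 r≈0) ⟩
    coeff p d                                ∎
    where open ≈-Reasoning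

  coeff-⊕-⊕ʳ : ∀ p q r d → coeff p d ≈ 0# → coeff q d ≈ 0# → coeff (p ⊕ (q ⊕ r)) d ≈ coeff r d
  coeff-⊕-⊕ʳ p q r d p≈0 q≈0 = begin
    coeff (p ⊕ (q ⊕ r)) d                    ≈⟨ coeff-⊕ p (q ⊕ r) d ⟩
    coeff p d F.+ coeff (q ⊕ r) d            ≈⟨ x≈0⇒x+y≈y p≈0 ⟩
    coeff (q ⊕ r) d                          ≈⟨ coeff-⊕ q r d ⟩
    coeff q d F.+ coeff r d                  ≈⟨ x≈0⇒x+y≈y q≈0 ⟩
    coeff r d                                ∎
    where open ≈-Reasoning

  coeff-altSign-≈0 : ∀ k p d → coeff p d ≈ 0# → coeff (altSign k p) d ≈ 0#
  coeff-altSign-≈0 zero    p d p≈0 = p≈0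
  coeff-altSign-≈0 (suc k) p d p≈0 =
    F.trans (coeff-neg (altSign k p) d) (x≈0⇒-x≈0 (coeff-altSign-≈0 k p d p≈0))

  coeff-altSign-≉0 : ∀ k p d → ¬ coeff p d ≈ 0# → ¬ coeff (altSign k p) d ≈ 0#
  coeff-altSign-≉0 zero    p d p≉0 = p≉0
  coeff-altSign-≉0 (suc k) p d p≉0 ±p≈0 =
    coeff-altSign-≉0 k p d p≉0 (-x≈0⇒x≈0 (F.trans (F.sym (coeff-neg (altSign k p) d)) ±p≈0))

  coeff-sumFin-≈0 : ∀ {n} (f : Fin n → Poly) d → (∀ j → coeff (f j) d ≈ 0#) → coeff (sumFin f) d ≈ 0#
  coeff-sumFin-≈0 {zero}  f d _   = F.refl
  coeff-sumFin-≈0 {suc n} f d f≈0 = F.trans (coeff-⊕ (f zero) (sumFin (f ∘ suc)) d)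
    (x≈0∧y≈0⇒x+y≈0 (f≈0 zero) (coeff-sumFin-≈0 (f ∘ suc) d (f≈0 ∘ suc)))

  coeff-sumFin-single : ∀ {n} (f : Fin n → Poly) d j₀ → (∀ j → j ≢ j₀ → coeff (f j) d ≈ 0#) →
                        coeff (sumFin f) d ≈ coeff (f j₀) d
  coeff-sumFin-single f d zero others = F.trans (coeff-⊕ (f zero) (sumFin (f ∘ suc)) d)
    (y≈0⇒x+y≈x (coeff-sumFin-≈0 (f ∘ suc) d (λ j → others (suc j) λ ())))
  coeff-sumFin-single f d (suc j₀) others = F.trans (coeff-⊕ (f zero) (sumFin (f ∘ suc)) d)
    (F.trans (x≈0⇒x+y≈y (others zero λ ()))
      (coeff-sumFin-single (f ∘ suc) d j₀ (λ j j≢j₀ → others (suc j) (j≢j₀ ∘ suc-injective))))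

  0∷-zero : ∀ {p} → IsZeroPoly p → IsZeroPoly (0# ∷ p)
  0∷-zero p≈0 zero    = F.refl
  0∷-zero p≈0 (suc d) = p≈0 d

  ⊗-zeroˡ : ∀ p q → IsZeroPoly p → IsZeroPoly (p ⊗ q)
  ⊗-zeroˡ []      q _   d = F.refl
  ⊗-zeroˡ (x ∷ p) q p≈0 d = F.trans (coeff-∷-⊗ x p q d)
    (x≈0∧y≈0⇒x+y≈0 (x≈0⇒x*y≈0 (p≈0 zero)) (0∷-zero (⊗-zeroˡ p q (p≈0 ∘ suc)) d))

  ⊗-zeroʳ : ∀ p q → IsZeroPoly q → IsZeroPoly (p ⊗ q)
  ⊗-zeroʳ []      q _   d = F.refl
  ⊗-zeroʳ (x ∷ p) q q≈0 d = F.trans (coeff-∷-⊗ x p q d)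
    (x≈0∧y≈0⇒x+y≈0 (y≈0⇒x*y≈0 (q≈0 d)) (0∷-zero (⊗-zeroʳ p q q≈0) d))

  coeff-top-≉0 : ∀ p d {x y} → coeff p d ≈ x F.* y → ¬ x ≈ 0# → ¬ y ≈ 0# → ¬ coeff p d ≈ 0#
  coeff-top-≉0 p d eq x≉0 y≉0 p≈0 = x≉0∧y≉0⇒x*y≉0 x≉0 y≉0 (F.trans (F.sym eq) p≈0)

  ZeroOrHasDeg : Poly → Set ℓ
  ZeroOrHasDeg p = IsZeroPoly p ⊎ ∃ (HasDeg p)

  -- Zero-testing in K is not decidable; the proof that the constant term x is
  -- nonzero re-enters the continuation with the zero case.
  zeroOrHasDeg : ∀ p → ¬ ¬ ZeroOrHasDeg p
  zeroOrHasDeg []      k = k (inj₁ λ _ → F.refl)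
  zeroOrHasDeg (x ∷ p) k = zeroOrHasDeg p λ
    { (inj₁ p≈0) → k (inj₂ (0 , (λ x≈0 → k (inj₁ λ { zero → x≈0 ; (suc i) → p≈0 i }))
                              , λ { (suc i) _ → p≈0 i }))
    ; (inj₂ (d , p≉0 , above)) → k (inj₂ (suc d , p≉0 , λ { (suc i) (s≤s d<i) → above i d<i }))
    }

  zeroOrHasDeg-all : ∀ {m} (v : Fin m → Poly) → ¬ ¬ (∀ j → ZeroOrHasDeg (v j))
  zeroOrHasDeg-all {zero}  v k = k λ ()
  zeroOrHasDeg-all {suc m} v k =
    zeroOrHasDeg (v zero) λ s₀ → zeroOrHasDeg-all (v ∘ suc) λ s → k λ { zero → s₀ ; (suc j) → s j }

  minor : ∀ {n} → (Fin (suc n) → Fin (suc n) → Poly) → Fin (suc n) → Fin n → Fin n → Poly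
  minor M j a b = M (suc a) (punchIn j b)

  module WeightedDegree (w : ℕ) .{{_ : NonZero w}} where

    -- w · deg p + a ≤ A, with deg 0 = -∞.
    record WDeg≤ (p : Poly) (a A : ℕ) : Set ℓ where
      constructor wdeg≤
      field vanishes : ∀ d → A < w * d + a → coeff p d ≈ 0#
    open WDeg≤ public

    zero-wdeg≤ : ∀ {p a A} → IsZeroPoly p → WDeg≤ p a A
    zero-wdeg≤ p≈0 = wdeg≤ λ d _ → p≈0 d

    DegLt⇒wdeg≤ : ∀ {p d a A} → DegLt p (suc d) → w * d + a ≤ A → WDeg≤ p a A
    DegLt⇒wdeg≤ p<d+1 le = wdeg≤ λ i lt → p<d+1 i (*-+-cancel-< w le lt)

    wdeg-weaken : ∀ {p a A a′ A′} → WDeg≤ p a A → A + a′ ≤ A′ + a → WDeg≤ p a′ A′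
    wdeg-weaken h le = wdeg≤ λ d lt → vanishes h d (<-transfer (w * d) le lt)

    wdeg-suc⇒ : ∀ {p a A} → WDeg≤ p (suc a) A → WDeg≤ p a A
    wdeg-suc⇒ {a = a} {A} h = wdeg-weaken h (+-monoʳ-≤ A (n≤1+n a))

    wdeg-suc-tight : ∀ {p a A d} → WDeg≤ p (suc a) A → w * d + a ≡ A → coeff p d ≈ 0#
    wdeg-suc-tight h eq = vanishes h _ (<-suc-tight eq)

    wdeg-⊕ : ∀ {p q a A} → WDeg≤ p a A → WDeg≤ q a A → WDeg≤ (p ⊕ q) a A
    wdeg-⊕ {p} {q} hp hq = wdeg≤ λ d lt →
      F.trans (coeff-⊕ p q d) (x≈0∧y≈0⇒x+y≈0 (vanishes hp d lt) (vanishes hq d lt))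

    wdeg-altSign : ∀ {p a A} k → WDeg≤ p a A → WDeg≤ (altSign k p) a A
    wdeg-altSign {p} k h = wdeg≤ λ d lt → coeff-altSign-≈0 k p d (vanishes h d lt)

    wdeg-sumFin : ∀ {n a A} (f : Fin n → Poly) → (∀ j → WDeg≤ (f j) a A) → WDeg≤ (sumFin f) a A
    wdeg-sumFin f h = wdeg≤ λ d lt → coeff-sumFin-≈0 f d (λ j → vanishes (h j) d lt)

    wdeg-head : ∀ {x p a A} → WDeg≤ (x ∷ p) a A → A < a → x ≈ 0#
    wdeg-head {a = a} {A} h lt = vanishes h 0 (subst (A <_) (cong (_+ a) (sym (*-zeroʳ w))) lt)

    wdeg-tail : ∀ {x p a A} → WDeg≤ (x ∷ p) a A → WDeg≤ p (w + a) A
    wdeg-tail {a = a} {A} h = wdeg≤ λ d lt → vanishes h (suc d) (subst (A <_) (sym (*-suc-+ w d a)) lt)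

    wdeg-0∷ : ∀ {p a A} → WDeg≤ p (w + a) A → WDeg≤ (0# ∷ p) a A
    wdeg-0∷ {a = a} {A} h = wdeg≤ λ
      { zero    _  → F.refl
      ; (suc d) lt → vanishes h d (subst (A <_) (*-suc-+ w d a) lt) }

    wdeg-D : ∀ {p a A} → WDeg≤ p a A → WDeg≤ (D p) (w + a) A
    wdeg-D {p} {a} {A} h = wdeg≤ λ d lt →
      F.trans (coeff-D p d) (ntimes-0 (suc d) (vanishes h (suc d) (subst (A <_) (sym (*-suc-+ w d a)) lt)))

    wdeg-scale : ∀ {x q a A b B} → (A < a → x ≈ 0#) → WDeg≤ q b B → WDeg≤ (scale x q) (a + b) (A + B)
    wdeg-scale {x} {q} {a} {A} {b} {B} x≈0 hq = wdeg≤ λ d lt → F.trans (coeff-scale x q d) (vanish d lt)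
      where
      vanish : ∀ d → A + B < w * d + (a + b) → x F.* coeff q d ≈ 0#
      vanish d lt with A <? a
      ... | yes A<a = x≈0⇒x*y≈0 (x≈0 A<a)
      ... | no  A≮a = y≈0⇒x*y≈0 (vanishes hq d (<-split (w * d) (≮⇒≥ A≮a) lt))

    wdeg-⊗ : ∀ {p a A q b B} → WDeg≤ p a A → WDeg≤ q b B → WDeg≤ (p ⊗ q) (a + b) (A + B)
    wdeg-⊗ {[]}             _  _  = zero-wdeg≤ λ _ → F.refl
    wdeg-⊗ {x ∷ p} {a} {A} {q} {b} {B} hp hq = wdeg-⊕ (wdeg-scale (wdeg-head hp) hq)
      (wdeg-0∷ (subst (λ o → WDeg≤ (p ⊗ q) o (A + B)) (+-assoc w a b) (wdeg-⊗ (wdeg-tail hp) hq)))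

    wdeg-⊗-shift : ∀ {M u S W δ a b} → WDeg≤ M 0 S → WDeg≤ u b W → S + a ≤ δ + b → WDeg≤ (M ⊗ u) a (W + δ)
    wdeg-⊗-shift {S = S} {W} {δ} {a} {b} hM hu le =
      wdeg-weaken (wdeg-⊗ hM hu) (shift-≤ {S} {a} {δ} {b} W le)

    coeff-⊗-top : ∀ {p a A q b B} e₁ e₂ → WDeg≤ p a A → WDeg≤ q b B → w * e₁ + a ≡ A → w * e₂ + b ≡ B →
                  coeff (p ⊗ q) (e₁ + e₂) ≈ coeff p e₁ F.* coeff q e₂
    coeff-⊗-top {[]} _ _ _ _ _ _ = F.sym (F.zeroˡ _)
    coeff-⊗-top {x ∷ p} {a} {A} {q} zero e₂ hp _ tight-p _ = begin
      coeff ((x ∷ p) ⊗ q) e₂                        ≈⟨ coeff-∷-⊗ x p q e₂ ⟩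
      x F.* coeff q e₂ F.+ coeff (0# ∷ (p ⊗ q)) e₂  ≈⟨ y≈0⇒x+y≈x (0∷-zero (⊗-zeroˡ p q tail≈0) e₂) ⟩
      x F.* coeff q e₂                              ∎
      where
      open ≈-Reasoning
      tail≈0 : IsZeroPoly p
      tail≈0 i = vanishes (wdeg-tail hp) i (tight-at-0⇒< w i tight-p)
    coeff-⊗-top {x ∷ p} {a} {A} {q} {b} {B} (suc e) e₂ hp hq tight-p tight-q = begin
      coeff ((x ∷ p) ⊗ q) (suc (e + e₂))
        ≈⟨ coeff-∷-⊗ x p q _ ⟩
      x F.* coeff q (suc (e + e₂)) F.+ coeff (p ⊗ q) (e + e₂)
        ≈⟨ x≈0⇒x+y≈y (y≈0⇒x*y≈0 (vanishes hq _ above)) ⟩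
      coeff (p ⊗ q) (e + e₂)
        ≈⟨ coeff-⊗-top e e₂ (wdeg-tail hp) hq tight-tail tight-q ⟩
      coeff p e F.* coeff q e₂
        ∎
      where
      open ≈-Reasoning
      above : B < w * suc (e + e₂) + b
      above = subst (_< _) tight-q (+-monoˡ-< b (*-monoʳ-< w (s≤s (m≤n+m e₂ e))))
      tight-tail : w * e + (w + a) ≡ A
      tight-tail = trans (sym (*-suc-+ w e a)) tight-p

    wdeg-det : ∀ {n} (M : Fin n → Fin n → Poly) {W β : Fin n → ℕ} →
               (∀ i j → WDeg≤ (M i j) (β j) (W i)) → WDeg≤ (det M) (sum β) (sum W)
    wdeg-det {zero} M _ = wdeg≤ λ
      { zero    lt → contradiction (subst (0 <_) (cong (_+ 0) (*-zeroʳ w)) lt) (<-irrefl refl)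
      ; (suc d) _  → F.refl }
    wdeg-det {suc n} M {W} {β} h = wdeg-sumFin _ λ j → wdeg-altSign (toℕ j)
      (subst (λ o → WDeg≤ (M zero j ⊗ det (minor M j)) o (sum W)) (sym (sum-remove {i = j} β))
        (wdeg-⊗ (h zero j) (wdeg-det (minor M j) λ a b → h (suc a) (punchIn j b))))

    record LeadingColumn {m} (β : Fin m → ℕ) (v : Fin m → Poly) : Set ℓ where
      field
        height  : ℕ
        column  : Fin m
        degree  : ℕ
        bounded : ∀ j → WDeg≤ (v j) (β j) height
        strict  : ∀ j → j ≢ column → WDeg≤ (v j) (suc (β j)) height
        tight   : w * degree + β column ≡ height
        nonzero : ¬ coeff (v column) degree ≈ 0#
    open LeadingColumn public

    leadingColumn-removeAt : ∀ {m β} {v : Fin (suc m) → Poly} (L : LeadingColumn β v) {j₀} →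
                             j₀ ≢ column L → LeadingColumn (β ∘ punchIn j₀) (v ∘ punchIn j₀)
    leadingColumn-removeAt {β = β} {v} L {j₀} j₀≢c = record
      { height  = height L
      ; column  = punchOut j₀≢c
      ; degree  = degree L
      ; bounded = bounded L ∘ punchIn j₀
      ; strict  = λ j j≢ → strict L (punchIn j₀ j)
                    (λ eq → j≢ (punchIn-injective j₀ j _ (trans eq (sym (punchIn-punchOut j₀≢c)))))
      ; tight   = subst (λ c → w * degree L + β c ≡ height L) (sym (punchIn-punchOut j₀≢c)) (tight L)
      ; nonzero = subst (λ c → ¬ coeff (v c) (degree L) ≈ 0#) (sym (punchIn-punchOut j₀≢c)) (nonzero L)
      }

    expansion-weight : ∀ {m β} {v : Fin (suc m) → Poly} (L : LeadingColumn β v) {E′ R} →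
                       w * E′ + sum (β ∘ punchIn (column L)) ≡ R →
                       w * (degree L + E′) + sum β ≡ height L + R
    expansion-weight {β = β} L {E′} {R} weight′ = begin
      w * (e + E′) + sum β                           ≡⟨ cong (w * (e + E′) +_) (sum-remove {i = c} β) ⟩
      w * (e + E′) + (β c + sum (β ∘ punchIn c))     ≡⟨ regroup w e E′ (β c) _ ⟩
      (w * e + β c) + (w * E′ + sum (β ∘ punchIn c)) ≡⟨ cong₂ _+_ (tight L) weight′ ⟩
      height L + R                                   ∎
      where
      open ≡-Reasoning
      c = column L
      e = degree L
      regroup : ∀ w e E b B → w * (e + E) + (b + B) ≡ (w * e + b) + (w * E + B)
      regroup = solve-∀

    det-top-≉0 : ∀ {n} (M : Fin (suc n) → Fin (suc n) → Poly) {β : Fin (suc n) → ℕ} {W : Fin n → ℕ}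
                 (L : LeadingColumn β (M zero)) → (∀ i j → WDeg≤ (M (suc i) j) (β j) (W i)) →
                 ∀ {E′} → w * E′ + sum (β ∘ punchIn (column L)) ≡ sum W →
                 ¬ coeff (det (minor M (column L))) E′ ≈ 0# → ¬ coeff (det M) (degree L + E′) ≈ 0#
    det-top-≉0 {n} M {β} {W} L bounded-below {E′} weight′ minor≉0 det≈0 =
      coeff-altSign-≉0 (toℕ j₀) (product j₀) E product≉0
        (F.trans (F.sym (coeff-sumFin-single term E j₀ others)) det≈0)
      where
      j₀ = column L
      E = degree L + E′
      product : Fin (suc n) → Poly
      product j = M zero j ⊗ det (minor M j)
      term : Fin (suc n) → Poly
      term j = altSign (toℕ j) (product j)
      wdeg-minor : ∀ j → WDeg≤ (det (minor M j)) (sum (β ∘ punchIn j)) (sum W)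
      wdeg-minor j = wdeg-det (minor M j) λ a b → bounded-below a (punchIn j b)
      others : ∀ j → j ≢ j₀ → coeff (term j) E ≈ 0#
      others j j≢j₀ = coeff-altSign-≈0 (toℕ j) (product j) E
        (vanishes (wdeg-⊗ (strict L j j≢j₀) (wdeg-minor j)) E
          (<-suc-tight (trans (cong (w * E +_) (sym (sum-remove {i = j} β))) (expansion-weight L weight′))))
      product≉0 : ¬ coeff (product j₀) E ≈ 0#
      product≉0 = coeff-top-≉0 (product j₀) E
        (coeff-⊗-top (degree L) E′ (bounded L j₀) (wdeg-minor j₀) (tight L) weight′) (nonzero L) minor≉0

    det-leading : ∀ {n} (M : Fin n → Fin n → Poly) {β : Fin n → ℕ} (L : ∀ i → LeadingColumn β (M i)) →
                  Injective _≡_ _≡_ (column ∘ L) →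
                  ∃ λ E → w * E + sum β ≡ sum (height ∘ L) × ¬ coeff (det M) E ≈ 0#
    det-leading {zero} M L _ = 0 , cong (_+ 0) (*-zeroʳ w) , λ 1≈0 → F.0≉1 (F.sym 1≈0)
    det-leading {suc n} M {β} L inj =
      let E′ , weight′ , minor≉0 = det-leading (minor M j₀) L′ L′-injective
      in degree (L zero) + E′ , expansion-weight (L zero) weight′ ,
         det-top-≉0 M (L zero) (bounded ∘ L ∘ suc) weight′ minor≉0
      where
      j₀ = column (L zero)
      j₀≢ : ∀ a → j₀ ≢ column (L (suc a))
      j₀≢ a eq with inj eq
      ... | ()
      L′ : ∀ a → LeadingColumn (β ∘ punchIn j₀) (minor M j₀ a)
      L′ a = leadingColumn-removeAt (L (suc a)) (j₀≢ a)
      L′-injective : Injective _≡_ _≡_ (column ∘ L′)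
      L′-injective eq = suc-injective (inj (punchOut-injective (j₀≢ _) (j₀≢ _) eq))

    det-nonzero : ∀ {n} (M : Fin n → Fin n → Poly) {β : Fin n → ℕ} (L : ∀ i → LeadingColumn β (M i)) →
                  Injective _≡_ _≡_ (column ∘ L) → ¬ IsZeroPoly (det M)
    det-nonzero M L inj det≈0 = let E , _ , det≉0 = det-leading M L inj in det≉0 (det≈0 E)

    leadingColumn-exists : ∀ {m} {β : Fin (suc m) → ℕ} → (∀ j → β j < w) → Injective _≡_ _≡_ β →
                           (v : Fin (suc m) → Poly) → ¬ (∀ j → IsZeroPoly (v j)) → ¬ ¬ LeadingColumn β v
    leadingColumn-exists {β = β} β<w β-injective v v≢0 k = zeroOrHasDeg-all v λ status →
      let c , maximal = maximum-attained (λ j → rank j (status j))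
      in from-maximum status c (status c) maximal
      where
      rank : ∀ j → ZeroOrHasDeg (v j) → ℕ
      rank j (inj₁ _)       = 0
      rank j (inj₂ (d , _)) = suc (w * d + β j)

      rank≤0⇒zero : ∀ j s → rank j s ≤ 0 → IsZeroPoly (v j)
      rank≤0⇒zero j (inj₁ v≈0) _ = v≈0

      bounded-by : ∀ {H} j s → rank j s ≤ suc H → WDeg≤ (v j) (β j) H
      bounded-by j (inj₁ v≈0)             _       = zero-wdeg≤ v≈0
      bounded-by j (inj₂ (d , _ , above)) (s≤s le) = DegLt⇒wdeg≤ above le

      strict-by : ∀ {c dc} j s → j ≢ c → rank j s ≤ suc (w * dc + β c) →
                  WDeg≤ (v j) (suc (β j)) (w * dc + β c)
      strict-by j (inj₁ v≈0) _ _ = zero-wdeg≤ v≈0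
      strict-by {c} {dc} j (inj₂ (d , _ , above)) j≢c (s≤s le) = DegLt⇒wdeg≤ above
        (subst (_≤ w * dc + β c) (sym (+-suc (w * d) (β j)))
          (≤∧≢⇒< le (j≢c ∘ β-injective ∘ digit-unique (β<w j) (β<w c))))

      from-maximum : (status : ∀ j → ZeroOrHasDeg (v j)) → ∀ c (sc : ZeroOrHasDeg (v c)) →
                     (∀ j → rank j (status j) ≤ rank c sc) → ⊥
      from-maximum status c (inj₁ _) maximal = v≢0 λ j → rank≤0⇒zero j (status j) (maximal j)
      from-maximum status c (inj₂ (dc , c≉0 , _)) maximal = k record
        { height  = w * dc + β c
        ; column  = c
        ; degree  = dc
        ; bounded = λ j → bounded-by j (status j) (maximal j)
        ; strict  = λ j j≢c → strict-by j (status j) j≢c (maximal j)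
        ; tight   = refl
        ; nonzero = c≉0
        }

  nextOr-fromℕ : ∀ {n} (v : Fin (suc n) → Poly) → nextOr v (fromℕ n) ≡ []
  nextOr-fromℕ {zero}  v = refl
  nextOr-fromℕ {suc n} v = nextOr-fromℕ (v ∘ suc)

  nextOr-inject₁ : ∀ {n} (v : Fin (suc n) → Poly) (i : Fin n) → nextOr v (inject₁ i) ≡ v (suc i)
  nextOr-inject₁ {suc n} v zero    = refl
  nextOr-inject₁ {suc n} v (suc i) = nextOr-inject₁ (v ∘ suc) i

  module Recurrence {n : ℕ} (T : Poly) (Q : Fin (suc n) → Poly) where

    open WeightedDegree (suc n)

    step : (Fin (suc n) → Poly) → Fin (suc n) → Poly
    step v j = (Q j ⊗ v zero) ⊕ ((T ⊗ D (v j)) ⊕ (T ⊗ nextOr v j))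

    -- Multiplication by T moves column i + 1 to column i, and multiplication by
    -- Qₘ moves column 1 to column m, both raising the weighted degree by exactly δ;
    -- every other contribution to the next row is strictly lower.
    record Grading : Set ℓ where
      field
        β           : Fin (suc n) → ℕ
        β<w         : ∀ j → β j < suc n
        β-injective : Injective _≡_ _≡_ β
        δ degT degQₘ degQ : ℕ
        T-deg       : HasDeg T degT
        Qₘ-deg      : HasDeg (Q (fromℕ n)) degQₘ
        Q-deg       : ∀ j → j ≢ fromℕ n → DegLt (Q j) (suc degQ)
        T-shift     : ∀ i → suc n * degT + β (inject₁ i) ≡ δ + β (suc i)
        Qₘ-shift    : suc n * degQₘ + β (fromℕ n) ≡ δ + β zero
        Q-below     : ∀ j → j ≢ fromℕ n → suc n * degQ + suc (β j) ≤ δ + β zero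
        TD-below    : suc n * degT + 1 ≤ δ + suc n

    module _ (G : Grading) where

      open Grading G

      T-wdeg : WDeg≤ T 0 (suc n * degT)
      T-wdeg = DegLt⇒wdeg≤ (proj₂ T-deg) (≤-reflexive (+-identityʳ _))

      Qₘ-wdeg : WDeg≤ (Q (fromℕ n)) 0 (suc n * degQₘ)
      Qₘ-wdeg = DegLt⇒wdeg≤ (proj₂ Qₘ-deg) (≤-reflexive (+-identityʳ _))

      Q-wdeg : ∀ j → j ≢ fromℕ n → WDeg≤ (Q j) 0 (suc n * degQ)
      Q-wdeg j j≢m = DegLt⇒wdeg≤ (Q-deg j j≢m) (≤-reflexive (+-identityʳ _))

      module StepBounds (v : Fin (suc n) → Poly) (W : ℕ) (bounded : ∀ j → WDeg≤ (v j) (β j) W) where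

        Q-term : ∀ j → j ≢ fromℕ n → WDeg≤ (Q j ⊗ v zero) (suc (β j)) (W + δ)
        Q-term j j≢m = wdeg-⊗-shift (Q-wdeg j j≢m) (bounded zero) (Q-below j j≢m)

        Qₘ-term : WDeg≤ (Q (fromℕ n) ⊗ v zero) (β (fromℕ n)) (W + δ)
        Qₘ-term = wdeg-⊗-shift Qₘ-wdeg (bounded zero) (≤-reflexive Qₘ-shift)

        Qₘ-term-strict : WDeg≤ (v zero) (suc (β zero)) W →
                         WDeg≤ (Q (fromℕ n) ⊗ v zero) (suc (β (fromℕ n))) (W + δ)
        Qₘ-term-strict h = wdeg-⊗-shift Qₘ-wdeg h (≤-reflexive (+-suc-≡ Qₘ-shift))

        TD-term : ∀ j → WDeg≤ (T ⊗ D (v j)) (suc (β j)) (W + δ)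
        TD-term j = wdeg-⊗-shift T-wdeg (wdeg-D (bounded j)) (+-suc-≤ (suc n) (β j) TD-below)

        T-term : ∀ i → WDeg≤ (T ⊗ v (suc i)) (β (inject₁ i)) (W + δ)
        T-term i = wdeg-⊗-shift T-wdeg (bounded (suc i)) (≤-reflexive (T-shift i))

        T-term-strict : ∀ i → WDeg≤ (v (suc i)) (suc (β (suc i))) W →
                        WDeg≤ (T ⊗ v (suc i)) (suc (β (inject₁ i))) (W + δ)
        T-term-strict i h = wdeg-⊗-shift T-wdeg h (≤-reflexive (+-suc-≡ (T-shift i)))

        T⊗[]≈0 : IsZeroPoly (T ⊗ [])
        T⊗[]≈0 = ⊗-zeroʳ T [] λ _ → F.refl

        step-bounded : ∀ j → WDeg≤ (step v j) (β j) (W + δ)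
        step-bounded j with view j
        ... | ‵fromℕ rewrite nextOr-fromℕ v =
          wdeg-⊕ Qₘ-term (wdeg-⊕ (wdeg-suc⇒ (TD-term _)) (zero-wdeg≤ T⊗[]≈0))
        ... | ‵inject₁ i rewrite nextOr-inject₁ v i =
          wdeg-⊕ (wdeg-suc⇒ (Q-term _ (fromℕ≢inject₁ ∘ sym))) (wdeg-⊕ (wdeg-suc⇒ (TD-term _)) (T-term i))

        step-strict : ∀ c → (∀ j → j ≢ c → WDeg≤ (v j) (suc (β j)) W) →
                      ∀ j → j ≢ cyclicPred c → WDeg≤ (step v j) (suc (β j)) (W + δ)
        step-strict c strict j j≢ with view j
        ... | ‵fromℕ rewrite nextOr-fromℕ v =
          wdeg-⊕ (Qₘ-term-strict (strict zero (j≢ ∘ cong cyclicPred)))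
            (wdeg-⊕ (TD-term _) (zero-wdeg≤ T⊗[]≈0))
        ... | ‵inject₁ i rewrite nextOr-inject₁ v i =
          wdeg-⊕ (Q-term _ (fromℕ≢inject₁ ∘ sym))
            (wdeg-⊕ (TD-term _) (T-term-strict i (strict (suc i) (j≢ ∘ cong cyclicPred))))

        step-top : ∀ {c e} → (∀ j → j ≢ c → WDeg≤ (v j) (suc (β j)) W) → suc n * e + β c ≡ W →
                   ¬ coeff (v c) e ≈ 0# →
                   ∃ λ e′ → suc n * e′ + β (cyclicPred c) ≡ W + δ × ¬ coeff (step v (cyclicPred c)) e′ ≈ 0#
        step-top {zero} {e} strict tight v≉0 = degQₘ + e , tight′ , top≉0
          where
          tight′ : suc n * (degQₘ + e) + β (fromℕ n) ≡ W + δ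
          tight′ = tight-shift (suc n) degQₘ tight Qₘ-shift
          top : coeff (step v (fromℕ n)) (degQₘ + e) ≈ coeff (Q (fromℕ n)) degQₘ F.* coeff (v zero) e
          top rewrite nextOr-fromℕ v = F.trans
            (coeff-⊕-⊕ˡ (Q (fromℕ n) ⊗ v zero) (T ⊗ D (v (fromℕ n))) (T ⊗ []) _
              (wdeg-suc-tight (TD-term _) tight′) (T⊗[]≈0 _))
            (coeff-⊗-top degQₘ e Qₘ-wdeg (bounded zero) (+-identityʳ _) tight)
          top≉0 : ¬ coeff (step v (fromℕ n)) (degQₘ + e) ≈ 0#
          top≉0 = coeff-top-≉0 (step v (fromℕ n)) _ top (proj₁ Qₘ-deg) v≉0
        step-top {suc i} {e} strict tight v≉0 = degT + e , tight′ , top≉0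
          where
          tight′ : suc n * (degT + e) + β (inject₁ i) ≡ W + δ
          tight′ = tight-shift (suc n) degT tight (T-shift i)
          top : coeff (step v (inject₁ i)) (degT + e) ≈ coeff T degT F.* coeff (v (suc i)) e
          top rewrite nextOr-inject₁ v i = F.trans
            (coeff-⊕-⊕ʳ (Q (inject₁ i) ⊗ v zero) (T ⊗ D (v (inject₁ i))) (T ⊗ v (suc i)) _
              (wdeg-suc-tight (Q-term _ (fromℕ≢inject₁ ∘ sym)) tight′) (wdeg-suc-tight (TD-term _) tight′))
            (coeff-⊗-top degT e T-wdeg (bounded (suc i)) (+-identityʳ _) tight)
          top≉0 : ¬ coeff (step v (inject₁ i)) (degT + e) ≈ 0#
          top≉0 = coeff-top-≉0 (step v (inject₁ i)) _ top (proj₁ T-deg) v≉0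

      leadingColumn-step : ∀ {v} → LeadingColumn β v → LeadingColumn β (step v)
      leadingColumn-step {v} L =
        let e′ , tight′ , nonzero′ = step-top (strict L) (tight L) (nonzero L)
        in record
          { height  = height L + δ
          ; column  = cyclicPred (column L)
          ; degree  = e′
          ; bounded = step-bounded
          ; strict  = step-strict (column L) (strict L)
          ; tight   = tight′
          ; nonzero = nonzero′
          }
        where open StepBounds v (height L) (bounded L)

      module _ (B₀ : Fin (suc n) → Poly) (L₀ : LeadingColumn β B₀) where

        leading : ∀ k → LeadingColumn β (Bseq T Q B₀ k)
        leading zero    = L₀
        leading (suc k) = leadingColumn-step (leading k)

        column-leading : ∀ k i → column (leading (k + i)) ≡ cyclicPred^ i (column (leading k))
        column-leading k zero    = cong (column ∘ leading) (+-identityʳ k)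
        column-leading k (suc i) =
          trans (cong (column ∘ leading) (+-suc k i)) (cong cyclicPred (column-leading k i))

        leading⇒detB≉0 : ∀ k → ¬ IsZeroPoly (detB T Q B₀ k)
        leading⇒detB≉0 k =
          det-nonzero (λ i → Bseq T Q B₀ (k + toℕ i)) (λ i → leading (k + toℕ i)) columns-distinct
          where
          columns-distinct : Injective _≡_ _≡_ (λ i → column (leading (k + toℕ i)))
          columns-distinct {a} {b} eq = toℕ-injective
            (cyclicPred^-injective (column (leading k)) (toℕ≤pred[n] a) (toℕ≤pred[n] b)
              (trans (sym (column-leading k (toℕ a))) (trans eq (column-leading k (toℕ b)))))

      detB≉0 : ∀ B₀ → ¬ (∀ j → IsZeroPoly (B₀ j)) → ∀ k → ¬ IsZeroPoly (detB T Q B₀ k)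
      detB≉0 B₀ B₀≢0 k detB≈0 =
        leadingColumn-exists β<w β-injective B₀ B₀≢0 λ L₀ → leading⇒detB≉0 B₀ L₀ k detB≈0

    Q-dominant : ∀ {S} → HasDeg T S → HasDeg (Q (fromℕ n)) (suc S) →
                 (∀ j → j ≢ fromℕ n → DegLt (Q j) (suc S)) → Grading
    Q-dominant {S} T-deg Qₘ-deg Q-deg = record
      { β           = λ j → n ∸ toℕ j
      ; β<w         = λ j → s≤s (m∸n≤m n (toℕ j))
      ; β-injective = λ {a} {b} eq → toℕ-injective (∸-cancelˡ-≡ (toℕ≤pred[n] a) (toℕ≤pred[n] b) eq)
      ; δ           = suc n * S + 1
      ; degT        = S
      ; degQₘ       = suc S
      ; degQ        = S
      ; T-deg       = T-deg
      ; Qₘ-deg      = Qₘ-deg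
      ; Q-deg       = Q-deg
      ; T-shift     = λ i → trans
          (cong (suc n * S +_) (trans (cong (n ∸_) (toℕ-inject₁ i)) (+-∸-assoc 1 (toℕ<n i))))
          (sym (+-assoc (suc n * S) 1 _))
      ; Qₘ-shift    = trans (cong (suc n * suc S +_) (trans (cong (n ∸_) (toℕ-fromℕ n)) (n∸n≡0 n)))
                            (regroup n S)
      ; Q-below     = λ j _ → ≤-trans (≤-reflexive (sym (+-assoc (suc n * S) 1 _)))
                                      (+-monoʳ-≤ (suc n * S + 1) (m∸n≤m n (toℕ j)))
      ; TD-below    = m≤m+n (suc n * S + 1) (suc n)
      }
      where
      regroup : ∀ n S → suc n * suc S + 0 ≡ suc n * S + 1 + n
      regroup = solve-∀

    T-dominant : ∀ {r} → 1 ≤ n → HasDeg T (suc r) → HasDeg (Q (fromℕ n)) r →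
                 (∀ j → j ≢ fromℕ n → DegLt (Q j) (suc r)) → Grading
    T-dominant {r} 1≤n T-deg Qₘ-deg Q-deg = record
      { β           = toℕ
      ; β<w         = toℕ<n
      ; β-injective = toℕ-injective
      ; δ           = suc n * r + n
      ; degT        = suc r
      ; degQₘ       = r
      ; degQ        = r
      ; T-deg       = T-deg
      ; Qₘ-deg      = Qₘ-deg
      ; Q-deg       = Q-deg
      ; T-shift     = λ i → trans (cong (suc n * suc r +_) (toℕ-inject₁ i)) (regroup n r (toℕ i))
      ; Qₘ-shift    = trans (cong (suc n * r +_) (toℕ-fromℕ n)) (sym (+-identityʳ _))
      ; Q-below     = λ j j≢m → ≤-trans (+-monoʳ-≤ (suc n * r) (toℕ<n-∖fromℕ j j≢m))
                                      (≤-reflexive (sym (+-identityʳ _)))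
      ; TD-below    = TD-below
      }
      where
      regroup : ∀ n r t → suc n * suc r + t ≡ suc n * r + n + suc t
      regroup = solve-∀
      toℕ<n-∖fromℕ : ∀ j → j ≢ fromℕ n → toℕ j < n
      toℕ<n-∖fromℕ j j≢m = ≤∧≢⇒< (toℕ≤pred[n] j) (λ eq → j≢m (toℕ-injective (trans eq (sym (toℕ-fromℕ n)))))
      TD-below : suc n * suc r + 1 ≤ suc n * r + n + suc n
      TD-below = begin
        suc n * suc r + 1        ≡⟨ regroup n r 1 ⟩
        suc n * r + n + 2        ≤⟨ +-monoʳ-≤ (suc n * r + n) (s≤s 1≤n) ⟩
        suc n * r + n + suc n    ∎
        where open ≤-Reasoning

theorem3p2 : {c ℓ : Level} (F : Field c ℓ) → let open FieldOps F in
    CharZero →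
    (n : ℕ) → 1 ≤ n →
    (T : Poly) (Q : Fin (suc n) → Poly) →
    ((∃ λ S′ → HasDeg T S′ × HasDeg (Q (fromℕ n)) (suc S′)
                × (∀ j → j ≢ fromℕ n → DegLt (Q j) (suc S′)))
     ⊎ (∃ λ r → HasDeg (Q (fromℕ n)) r × HasDeg T (suc r)
                × (∀ j → DegLt (Q j) (suc r)))) →
    (B₀ : Fin (suc n) → Poly) → ¬ (∀ j → IsZeroPoly (B₀ j)) →
    ∀ k → ¬ IsZeroPoly (detB T Q B₀ k)
theorem3p2 F _ _ _ T Q (inj₁ (_ , T-deg , Qₘ-deg , Q-deg)) =
  Recurrence.detB≉0 F T Q (Recurrence.Q-dominant F T Q T-deg Qₘ-deg Q-deg)
theorem3p2 F _ _ 1≤n T Q (inj₂ (_ , Qₘ-deg , T-deg , Q-deg)) =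
  Recurrence.detB≉0 F T Q (Recurrence.T-dominant F T Q 1≤n T-deg Qₘ-deg (λ j _ → Q-deg j))
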